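{- For every database $D$ and every finite rule set $\Sigma$, there is a run of the machine $\mathcal{M}_\Sigma$ on the encoding of $D$ that visits the state $q_r$ infinitely often if and only if there is a non-terminating (i.e. infinite) restricted chase sequence for $\langle\Sigma,D\rangle$.
   Context: Existential rules, databases, knowledge bases $\langle\Sigma,D\rangle$, triggers (loaded / obsolete / output with fresh nulls) are as usual: a trigger $\langle R,\sigma\rangle$, $R\in\Sigma$, $\sigma$ defined on the universal variables of $R$, is loaded for $F$ if $\sigma(\mathrm{body}(R))\subseteq F$ and obsolete for $F$ if some extension $\sigma'$ to the existential variables has $\sigma'(\mathrm{head}(R))\subseteq F$. A restricted chase sequence is a sequence $F_0=D,F_1,\dots$ with $F_{i+1}=F_i\cup\mathrm{output}(\lambda)$ for a $\Sigma$-trigger $\lambda$ loaded and not obsolete for $F_i$, satisfying fairness: every $\Sigma$-trigger loaded for some $F_i$ is obsolete for some $F_j$ with $j\ge i$. For a fact set $F$, let $\mathit{active}(F)$ be the set of $\Sigma$-triggers loaded and not obsolete for $F$. $\mathcal{M}_\Sigma$ is the non-deterministic Turing machine with start state $q_0$ and a designated state $q_r$ that executes: (1) check that the input tape contains a valid encoding of a database; if not, halt. (2) Initialise counters $i=j=0$ and $F_0$ as the encoded database. (3) If $\mathit{active}(F_i)$ is empty, halt. (4) Non-deterministically pick a trigger $\langle R,\sigma\rangle\in\mathit{active}(F_i)$ and let $F_{i+1}=F_i\cup\sigma'(\mathrm{head}(R))$ where $\sigma'$ extends $\sigma$ by mapping existential variables to nulls not occurring in $F_i$. (5) If all triggers in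 $\mathit{active}(F_j)$ are obsolete for $F_i$, increment $j$ and visit $q_r$ once. (6) Increment $i$ and go to (3). -}

module Defs where

open import Data.Nat using (ℕ; suc; _≤_)
open import Data.Unit using (⊤)
open import Data.Empty using (⊥)
open import Data.List using (List; map; _++_; concatMap)
open import Data.List.Membership.Propositional using (_∈_; _∉_)
open import Data.List.Relation.Unary.All using (All)
open import Data.Product using (Σ; ∃; ∃-syntax; _×_)
open import Data.Sum using (_⊎_)
open import Relation.Binary.PropositionalEquality using (_≡_)
open import Relation.Nullary using (¬_)

data GTerm : Set where
  const : ℕ → GTerm
  null  : ℕ → GTerm

data RTerm : Set where
  var : ℕ → RTerm
  cst : ℕ → RTerm

record Atom (T : Set) : Set where
  constructor atom
  field
    pred : ℕ
    args : List T
open Atom public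

Fact : Set
Fact = Atom GTerm

FactSet : Set
FactSet = List Fact   -- a finite set of facts, represented by a list

record Rule : Set where
  constructor _⇒_
  field
    body : List (Atom RTerm)
    head : List (Atom RTerm)
open Rule public

IsConst : GTerm → Set
IsConst (const _) = ⊤
IsConst (null _)  = ⊥

IsDatabase : FactSet → Set
IsDatabase D = All (λ f → All IsConst (args f)) D

varsT : RTerm → List ℕ
varsT (var x) = x Data.List.∷ Data.List.[]
varsT (cst _) = Data.List.[]

varsA : Atom RTerm → List ℕ
varsA a = concatMap varsT (args a)

bodyVars : Rule → List ℕ
bodyVars R = concatMap varsA (body R)

headVars : Rule → List ℕ
headVars R = concatMap varsA (head R)

Universal : Rule → ℕ → Set
Universal R x = x ∈ bodyVars R

Existential : Rule → ℕ → Set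
Existential R x = x ∈ headVars R × x ∉ bodyVars R

Subst : Set
Subst = ℕ → GTerm

substT : Subst → RTerm → GTerm
substT σ (var x) = σ x
substT σ (cst c) = const c

substA : Subst → Atom RTerm → Fact
substA σ (atom p ts) = atom p (map (substT σ) ts)

OccursNull : ℕ → FactSet → Set
OccursNull n F = ∃[ f ] (f ∈ F × null n ∈ args f)

-- Triggers (σ is only relevant on the universal variables of the rule)

record Trigger (Σ : List Rule) : Set where
  constructor trigger
  field
    rule  : Rule
    rule∈ : rule ∈ Σ
    σ     : Subst
open Trigger public

Extends : Rule → Subst → Subst → Set
Extends R σ σ' = ∀ x → Universal R x → σ' x ≡ σ x

Loaded : ∀ {Σ} → FactSet → Trigger Σ → Set
Loaded F t = All (λ a → substA (σ t) a ∈ F) (body (rule t))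

Obsolete : ∀ {Σ} → FactSet → Trigger Σ → Set
Obsolete F t = ∃[ σ' ] (Extends (rule t) (σ t) σ' ×
                        All (λ a → substA σ' a ∈ F) (head (rule t)))

Active : ∀ {Σ} → FactSet → Trigger Σ → Set
Active F t = Loaded F t × ¬ Obsolete F t

FreshExtension : ∀ {Σ} → FactSet → Trigger Σ → Subst → Set
FreshExtension F t σ' =
  Extends (rule t) (σ t) σ' ×
  (∀ x → Existential (rule t) x → ∃[ n ] (σ' x ≡ null n × ¬ OccursNull n F)) ×
  (∀ x y → Existential (rule t) x → Existential (rule t) y → σ' x ≡ σ' y → x ≡ y)

output : Subst → Rule → FactSet
output σ' R = map (substA σ') (head R)

Step : (Σ : List Rule) → FactSet → FactSet → Set
Step Σ F F' = ∃[ t ] (Active {Σ} F t ×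
              ∃[ σ' ] (FreshExtension F t σ' × F' ≡ F ++ output σ' (rule t)))

Fair : (Σ : List Rule) → (ℕ → FactSet) → Set
Fair Σ F = ∀ i (t : Trigger Σ) → Loaded (F i) t → ∃[ j ] (i ≤ j × Obsolete (F j) t)

InfiniteRestrictedChase : (Σ : List Rule) → FactSet → (ℕ → FactSet) → Set
InfiniteRestrictedChase Σ D F =
  F 0 ≡ D × (∀ i → Step Σ (F i) (F (suc i))) × Fair Σ F

-- Infinite runs of the machine M_Σ (abstract model of steps (2)-(6))
-- F k = the fact set F_i at the start of the k-th loop iteration (i = k),
-- J k = the value of the counter j at that point.

-- condition of step (5) in iteration k: all triggers in active(F_j)
-- are obsolete for F_i
VisitsQr : (Σ : List Rule) → (ℕ → FactSet) → (ℕ → ℕ) → ℕ → Set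
VisitsQr Σ F J k = ∀ (t : Trigger Σ) → Active (F (J k)) t → Obsolete (F k) t

MachineRun : (Σ : List Rule) → FactSet → (ℕ → FactSet) → (ℕ → ℕ) → Set
MachineRun Σ D F J =
  F 0 ≡ D × J 0 ≡ 0 ×
  (∀ k → Step Σ (F k) (F (suc k))) ×
  (∀ k → (VisitsQr Σ F J k × J (suc k) ≡ suc (J k))
       ⊎ (¬ VisitsQr Σ F J k × J (suc k) ≡ J k))

InfinitelyOftenQr : (Σ : List Rule) → (ℕ → FactSet) → (ℕ → ℕ) → Set
InfinitelyOftenQr Σ F J = ∀ n → ∃[ k ] (n ≤ k × VisitsQr Σ F J k)

{-# OPTIONS --safe #-}
module Submission where

open import Defs
open import Data.Empty using (⊥-elim)
open import Data.List using (List; []; _∷_; map; concat; concatMap)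
open import Data.List.Properties using (≡-dec; map-cong-local)
open import Data.List.Membership.Propositional using (_∈_; mapWith∈; find; lose)
open import Data.List.Membership.Propositional.Properties
  using (∈-map⁺; ∈-++⁺ˡ; ∈-concat⁺; ∈-concatMap⁺; ∈-concatMap⁻)
import Data.List.Membership.DecPropositional as DecMembership
open import Data.List.Relation.Binary.Subset.Propositional using (_⊆_)
open import Data.List.Relation.Unary.All as All using (All; []; _∷_; all?)
open import Data.List.Relation.Unary.Any using (Any; here; there; any?)
open import Data.List.Relation.Unary.Any.Properties using (mapWith∈⁺)
open import Data.Nat using (ℕ; zero; suc; _+_; _⊔_; _≤_; _≤′_; _≤‴_; z≤n; s≤s; _≟_)
open import Data.Nat.Base using (≤′-refl; ≤′-step; ≤‴-refl; ≤‴-step)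
open import Data.Nat.Properties
  using (≤-refl; <⇒≤; m≤m⊔n; m≤n⊔m; m≤m+n; m≤n+m; m≤n⇒m≤1+n; ≤⇒≤′; ≤⇒≤‴)
open import Data.Product using (_×_; ∃-syntax; _,_)
open import Data.Sum using (_⊎_; inj₁; inj₂)
open import Function.Bundles using (_⇔_; mk⇔)
open import Relation.Binary.Definitions using (DecidableEquality)
open import Relation.Binary.PropositionalEquality using (_≡_; refl; sym; trans; cong; cong₂; subst)
open import Relation.Nullary using (¬_; Dec; yes; no)
open import Relation.Nullary.Decidable using (map′; _×-dec_; _→-dec_; ¬?)

-- The machine and the chase run through the same fact sets; the machine's counter j only
-- moves past F_j once every trigger active for F_j has become obsolete.  So q_r is visited
-- infinitely often iff every level j is eventually settled, which is exactly fairness.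
-- For the converse the counter has to be computed: up to the values of σ on universal
-- variables, which range over the finitely many terms of F_j, active(F_j) is a finite
-- list of triggers, and obsolescence is decidable by trying all assignments of the head
-- variables to terms of F.

_≟ᵗ_ : DecidableEquality GTerm
const m ≟ᵗ const n = map′ (cong const) (λ { refl → refl }) (m ≟ n)
const _ ≟ᵗ null _  = no λ ()
null _  ≟ᵗ const _ = no λ ()
null m  ≟ᵗ null n  = map′ (cong null) (λ { refl → refl }) (m ≟ n)

_≟ᶠ_ : DecidableEquality Fact
atom p ts ≟ᶠ atom q us =
  map′ (λ (p≡q , ts≡us) → cong₂ atom p≡q ts≡us) (λ { refl → refl , refl })
       (p ≟ q ×-dec ≡-dec _≟ᵗ_ ts us)

open DecMembership _≟ᶠ_ using (_∈?_)

AgreeOn : List ℕ → Subst → Subst → Set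
AgreeOn xs s τ = ∀ x → x ∈ xs → s x ≡ τ x

substT-cong : ∀ {s τ} u → AgreeOn (varsT u) s τ → substT s u ≡ substT τ u
substT-cong (var x) agree = agree x (here refl)
substT-cong (cst _) agree = refl

substA-cong : ∀ {s τ} a → AgreeOn (varsA a) s τ → substA s a ≡ substA τ a
substA-cong a agree = cong (atom (pred a)) (map-cong-local (All.tabulate λ {u} u∈ →
  substT-cong u (λ x x∈ → agree x (∈-concatMap⁺ varsT (lose u∈ x∈)))))

substA-All-cong : ∀ {F s τ} as → AgreeOn (concatMap varsA as) s τ →
                  All (λ a → substA τ a ∈ F) as → All (λ a → substA s a ∈ F) as
substA-All-cong {F} as agree τ[as]⊆F = All.tabulate λ {a} a∈ →
  subst (_∈ F) (sym (substA-cong a λ x x∈ → agree x (∈-concatMap⁺ varsA (lose a∈ x∈))))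
        (All.lookup τ[as]⊆F a∈)

var∈args : ∀ {x} (s : Subst) a → x ∈ varsA a → s x ∈ args (substA s a)
var∈args s a x∈ with find (∈-concatMap⁻ varsT x∈)
... | var _ , u∈ , here refl = ∈-map⁺ (substT s) u∈

terms : FactSet → List GTerm
terms = concatMap args

var∈terms : ∀ {F x} (s : Subst) as → x ∈ concatMap varsA as →
            All (λ a → substA s a ∈ F) as → s x ∈ terms F
var∈terms s as x∈ as⊆F with find (∈-concatMap⁻ varsA x∈)
... | a , a∈ , x∈a = ∈-concatMap⁺ args (lose (All.lookup as⊆F a∈) (var∈args s a x∈a))

_[_↦_] : Subst → ℕ → GTerm → Subst
(s [ x ↦ u ]) y with y ≟ x
... | yes _ = u
... | no _  = s y

assignments : List ℕ → List GTerm → Subst → List Subst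
assignments []       T s = s ∷ []
assignments (x ∷ xs) T s =
  concatMap (λ s′ → map (λ u → s′ [ x ↦ u ]) T) (assignments xs T s)

assignments-complete :
  ∀ xs T s (τ : Subst) → (∀ x → x ∈ xs → τ x ∈ T) →
  ∃[ s′ ] (s′ ∈ assignments xs T s × AgreeOn xs s′ τ × (∀ y → s′ y ≡ τ y ⊎ s′ y ≡ s y))
assignments-complete [] T s τ _ = s , here refl , (λ _ ()) , λ _ → inj₂ refl
assignments-complete (x ∷ xs) T s τ τ[x∷xs]⊆T
  with assignments-complete xs T s τ (λ y y∈ → τ[x∷xs]⊆T y (there y∈))
... | s′ , s′∈ , agree , pointwise =
  s′ [ x ↦ τ x ] ,
  ∈-concatMap⁺ (λ s″ → map (λ u → s″ [ x ↦ u ]) T) (lose s′∈ (∈-map⁺ (λ u → s′ [ x ↦ u ]) (τ[x∷xs]⊆T x (here refl)))) ,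
  agree′ , pointwise′
  where
  agree′ : AgreeOn (x ∷ xs) (s′ [ x ↦ τ x ]) τ
  agree′ y y∈ with y ≟ x | y∈
  ... | yes refl | _        = refl
  ... | no y≢x   | here y≡x = ⊥-elim (y≢x y≡x)
  ... | no _     | there y∈ = agree y y∈

  pointwise′ : ∀ y → (s′ [ x ↦ τ x ]) y ≡ τ y ⊎ (s′ [ x ↦ τ x ]) y ≡ s y
  pointwise′ y with y ≟ x
  ... | yes refl = inj₁ refl
  ... | no _     = pointwise y

module _ {Σ : List Rule} where

  loaded? : ∀ F (t : Trigger Σ) → Dec (Loaded F t)
  loaded? F t = all? (λ a → substA (σ t) a ∈? F) (body (rule t))

  Obsolete-⊆ : ∀ {F F′} (t : Trigger Σ) → F ⊆ F′ → Obsolete F t → Obsolete F′ t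
  Obsolete-⊆ t F⊆F′ (s , ext , head⊆F) = s , ext , All.map F⊆F′ head⊆F

  obsolete? : ∀ F (t : Trigger Σ) → Dec (Obsolete F t)
  obsolete? F t@(trigger R _ τ) = map′ sound complete (any? witness? candidates)
    where
    candidates : List Subst
    candidates = assignments (headVars R) (terms F) τ

    Witness : Subst → Set
    Witness s = All (λ x → s x ≡ τ x) (bodyVars R) × All (λ a → substA s a ∈ F) (head R)

    witness? : ∀ s → Dec (Witness s)
    witness? s = all? (λ x → s x ≟ᵗ τ x) (bodyVars R) ×-dec all? (λ a → substA s a ∈? F) (head R)

    sound : Any Witness candidates → Obsolete F t
    sound any with find any
    ... | s , _ , ext , head⊆F = s , (λ x x∈ → All.lookup ext x∈) , head⊆F

    complete : Obsolete F t → Any Witness candidates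
    complete (τ′ , ext , head⊆F)
      with assignments-complete (headVars R) (terms F) τ τ′ (λ x x∈ → var∈terms τ′ (head R) x∈ head⊆F)
    ... | s , s∈ , agree , pointwise =
      lose s∈ (All.tabulate extends , substA-All-cong (head R) agree head⊆F)
      where
      extends : ∀ {x} → x ∈ bodyVars R → s x ≡ τ x
      extends {x} x∈ with pointwise x
      ... | inj₁ s≡τ′ = trans s≡τ′ (ext x x∈)
      ... | inj₂ s≡τ  = s≡τ

  -- The value const 0 off the universal variables is arbitrary: Loaded and Obsolete
  -- only depend on the substitution through the universal variables.
  triggersOver : FactSet → List (Trigger Σ)
  triggersOver F = concat (mapWith∈ Σ λ {R} R∈ →
    map (trigger R R∈) (assignments (bodyVars R) (terms F) λ _ → const 0))

  triggersOver-complete :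
    ∀ {F} (t : Trigger Σ) → Loaded F t →
    ∃[ c ] (c ∈ triggersOver F × Loaded F c × (∀ {F′} → Obsolete F′ c → Obsolete F′ t))
  triggersOver-complete {F} (trigger R R∈ τ) body⊆F
    with assignments-complete (bodyVars R) (terms F) (λ _ → const 0) τ
           (λ x x∈ → var∈terms τ (body R) x∈ body⊆F)
  ... | s , s∈ , agree , _ =
    trigger R R∈ s ,
    ∈-concat⁺ (mapWith∈⁺ _ (R , R∈ , ∈-map⁺ (trigger R R∈) s∈)) ,
    substA-All-cong (body R) agree body⊆F ,
    λ (τ′ , ext , head⊆F′) → τ′ , (λ x x∈ → trans (ext x x∈) (agree x x∈)) , head⊆F′

  AllActiveObsolete : FactSet → FactSet → Set
  AllActiveObsolete F F′ = ∀ (t : Trigger Σ) → Active F t → Obsolete F′ t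

  allActiveObsolete? : ∀ F F′ → Dec (AllActiveObsolete F F′)
  allActiveObsolete? F F′ = map′ sound complete (all? representative? (triggersOver F))
    where
    Representative : Trigger Σ → Set
    Representative c = Loaded F c → ¬ Obsolete F c → Obsolete F′ c

    representative? : ∀ c → Dec (Representative c)
    representative? c = loaded? F c →-dec ¬? (obsolete? F c) →-dec obsolete? F′ c

    sound : All Representative (triggersOver F) → AllActiveObsolete F F′
    sound all t (loaded , ¬obsolete) with triggersOver-complete t loaded
    ... | c , c∈ , loaded-c , c⇒t =
      c⇒t (All.lookup all c∈ loaded-c (λ obsolete-c → ¬obsolete (c⇒t obsolete-c)))

    complete : AllActiveObsolete F F′ → All Representative (triggersOver F)
    complete all = All.tabulate λ {c} _ loaded ¬obsolete → all c (loaded , ¬obsolete)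

allEventually : ∀ {A : Set} {P : A → ℕ → Set} → (∀ a {i j} → i ≤ j → P a i → P a j) →
                ∀ {xs} → All (λ a → ∃[ i ] P a i) xs → ∃[ B ] All (λ a → P a B) xs
allEventually mono [] = 0 , []
allEventually mono ((i , p) ∷ ps) with allEventually mono ps
... | B , qs = i ⊔ B , mono _ (m≤m⊔n i B) p ∷ All.map (mono _ (m≤n⊔m i B)) qs

⊆-chain : ∀ (F : ℕ → FactSet) → (∀ i → F i ⊆ F (suc i)) → ∀ {i j} → i ≤ j → F i ⊆ F j
⊆-chain F step i≤j = go (≤⇒≤′ i≤j)
  where
  go : ∀ {i j} → i ≤′ j → F i ⊆ F j
  go ≤′-refl        = λ f∈ → f∈
  go (≤′-step i≤′j) = λ f∈ → step _ (go i≤′j f∈)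

Step⇒⊆ : ∀ {Σ F F′} → Step Σ F F′ → F ⊆ F′
Step⇒⊆ (_ , _ , _ , _ , refl) = ∈-++⁺ˡ

module _ {Σ : List Rule} {F : ℕ → FactSet} (steps : ∀ i → Step Σ (F i) (F (suc i))) where

  chase-⊆ : ∀ {i j} → i ≤ j → F i ⊆ F j
  chase-⊆ = ⊆-chain F (λ i → Step⇒⊆ (steps i))

  AllActiveObsolete-mono : ∀ {m i j} → i ≤ j →
    AllActiveObsolete {Σ} (F m) (F i) → AllActiveObsolete (F m) (F j)
  AllActiveObsolete-mono i≤j settled t active = Obsolete-⊆ t (chase-⊆ i≤j) (settled t active)

  fair⇒activeEventuallyObsolete : Fair Σ F → ∀ m → ∃[ B ] AllActiveObsolete (F m) (F B)
  fair⇒activeEventuallyObsolete fair m =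
    let B , obsolete = allEventually ObsoleteIfLoaded-mono
                         (All.tabulate {xs = triggersOver (F m)} λ {c} _ → eventually c)
    in B , λ t (loaded , _) →
         let c , c∈ , loaded-c , c⇒t = triggersOver-complete t loaded
         in c⇒t (All.lookup obsolete c∈ loaded-c)
    where
    ObsoleteIfLoaded : Trigger Σ → ℕ → Set
    ObsoleteIfLoaded c j = Loaded (F m) c → Obsolete (F j) c

    ObsoleteIfLoaded-mono : ∀ c {i j} → i ≤ j → ObsoleteIfLoaded c i → ObsoleteIfLoaded c j
    ObsoleteIfLoaded-mono c i≤j obsolete loaded = Obsolete-⊆ c (chase-⊆ i≤j) (obsolete loaded)

    eventually : ∀ c → ∃[ j ] ObsoleteIfLoaded c j
    eventually c with loaded? (F m) c
    ... | no ¬loaded = 0 , λ loaded → ⊥-elim (¬loaded loaded)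
    ... | yes loaded with fair m c loaded
    ...   | j , _ , obsolete = j , λ _ → obsolete

-- Step (5) of the machine with "all triggers in active(F_m) are obsolete for F_k"
-- abstracted to Q m k.
module Counter (Q : ℕ → ℕ → Set) (J : ℕ → ℕ)
  (J-step : ∀ k → (Q (J k) k × J (suc k) ≡ suc (J k)) ⊎ (¬ Q (J k) k × J (suc k) ≡ J k))
  where

  Visit : ℕ → Set
  Visit k = Q (J k) k

  J≤id : J 0 ≡ 0 → ∀ k → J k ≤ k
  J≤id J0 zero = subst (_≤ 0) (sym J0) z≤n
  J≤id J0 (suc k) with J-step k
  ... | inj₁ (_ , e) = subst (_≤ suc k) (sym e) (s≤s (J≤id J0 k))
  ... | inj₂ (_ , e) = subst (_≤ suc k) (sym e) (m≤n⇒m≤1+n (J≤id J0 k))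

  visitedOrStalled : ∀ {k k′} → k ≤‴ k′ → (∃[ m ] (k ≤ m × J m ≡ J k × Visit m)) ⊎ J k′ ≡ J k
  visitedOrStalled ≤‴-refl = inj₂ refl
  visitedOrStalled {k} (≤‴-step k<k′) with J-step k
  ... | inj₁ (visit , _) = inj₁ (k , ≤-refl , refl , visit)
  ... | inj₂ (_ , stall) with visitedOrStalled k<k′
  ...   | inj₁ (m , k<m , Jm≡ , visit) = inj₁ (m , <⇒≤ k<m , trans Jm≡ stall , visit)
  ...   | inj₂ Jk′≡ = inj₂ (trans Jk′≡ stall)

  visitsUnbounded : (∀ {m i j} → i ≤ j → Q m i → Q m j) → (∀ m → ∃[ k ] Q m k) →
                    ∀ n → ∃[ k ] (n ≤ k × Visit k)
  visitsUnbounded mono settles n with settles (J n)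
  ... | B , settled with visitedOrStalled (≤⇒≤‴ (m≤n+m n B))
  ...   | inj₁ (k , n≤k , _ , visit) = k , n≤k , visit
  ...   | inj₂ stall =
    B + n , m≤n+m n B , subst (λ j → Q j (B + n)) (sym stall) (mono (m≤m+n B n) settled)

  everyLevelVisited : J 0 ≡ 0 → (∀ n → ∃[ k ] (n ≤ k × Visit k)) →
                      ∀ n → ∃[ k ] (J k ≡ n × Visit k)
  everyLevelVisited J0 visits = level
    where
    visitAtLevelOf : ∀ k → ∃[ m ] (J m ≡ J k × Visit m)
    visitAtLevelOf k with visits k
    ... | k′ , k≤k′ , visit with visitedOrStalled (≤⇒≤‴ k≤k′)
    ...   | inj₁ (m , _ , Jm≡ , visit′) = m , Jm≡ , visit′
    ...   | inj₂ Jk′≡ = k′ , Jk′≡ , visit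

    level : ∀ n → ∃[ k ] (J k ≡ n × Visit k)
    level zero with visitAtLevelOf 0
    ... | m , Jm≡ , visit = m , trans Jm≡ J0 , visit
    level (suc n) with level n
    ... | k , refl , visit with J-step k
    ...   | inj₂ (¬visit , _) = ⊥-elim (¬visit visit)
    ...   | inj₁ (_ , advance) with visitAtLevelOf (suc k)
    ...     | m , Jm≡ , visit′ = m , trans Jm≡ advance , visit′

module _ {Q : ℕ → ℕ → Set} (Q? : ∀ m k → Dec (Q m k)) where

  counter : ℕ → ℕ
  counter zero = 0
  counter (suc k) with Q? (counter k) k
  ... | yes _ = suc (counter k)
  ... | no _  = counter k

  counter-step : ∀ k → (Q (counter k) k × counter (suc k) ≡ suc (counter k))
                     ⊎ (¬ Q (counter k) k × counter (suc k) ≡ counter k)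
  counter-step k with Q? (counter k) k
  ... | yes settled = inj₁ (settled , refl)
  ... | no ¬settled = inj₂ (¬settled , refl)

machineRun⇒fair : ∀ {Σ D F J} → MachineRun Σ D F J → InfinitelyOftenQr Σ F J → Fair Σ F
machineRun⇒fair {Σ} {F = F} {J} (_ , J0 , steps , J-step) visits i t loaded =
  obsoleteAtVisit loaded (everyLevelVisited J0 visits i)
  where
  open Counter (λ m k → AllActiveObsolete {Σ} (F m) (F k)) J J-step

  obsoleteAtVisit : ∀ {i} → Loaded (F i) t → ∃[ k ] (J k ≡ i × Visit k) →
                    ∃[ j ] (i ≤ j × Obsolete (F j) t)
  obsoleteAtVisit loaded (k , refl , settled) with obsolete? (F (J k)) t
  ... | yes obsolete = k , J≤id J0 k , Obsolete-⊆ t (chase-⊆ steps (J≤id J0 k)) obsolete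
  ... | no ¬obsolete = k , J≤id J0 k , settled t (loaded , ¬obsolete)

chase⇒machineRun : ∀ {Σ D F} → InfiniteRestrictedChase Σ D F →
                  ∃[ J ] (MachineRun Σ D F J × InfinitelyOftenQr Σ F J)
chase⇒machineRun {Σ} {F = F} (F0 , steps , fair) =
  J , (F0 , refl , steps , counter-step settled?) ,
  visitsUnbounded (AllActiveObsolete-mono steps) (fair⇒activeEventuallyObsolete steps fair)
  where
  Settled : ℕ → ℕ → Set
  Settled m k = AllActiveObsolete {Σ} (F m) (F k)

  settled? : ∀ m k → Dec (Settled m k)
  settled? m k = allActiveObsolete? (F m) (F k)

  J : ℕ → ℕ
  J = counter settled?

  open Counter Settled J (counter-step settled?)

lemma4p3 : (Σ : List Rule) (D : FactSet) → IsDatabase D →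
    (∃[ F ] ∃[ J ] (MachineRun Σ D F J × InfinitelyOftenQr Σ F J))
      ⇔ (∃[ F ] InfiniteRestrictedChase Σ D F)
lemma4p3 Σ D _ = mk⇔
  (λ (F , J , run@(F0 , _ , steps , _) , visits) → F , F0 , steps , machineRun⇒fair run visits)
  (λ (F , chase) → F , chase⇒machineRun chase)
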